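{- Let $g,k$ be integers with $2\le k<g$. Then $Y(g,k)$ is a 1089 graph if and only if $(k+1)\mid g$. Moreover, if $Y(g,k)$ is a 1089 graph and $g=b(k+1)$ with $b$ a positive integer, then $Y(g,k)$ consists exactly of the starting node $[[0,0]]$ and the four nodes $[0,k-1]$, $[k-1,k-1]$, $[k-1,0]$, $[0,0]$, with exactly the following edges: $[[0,0]]\to[0,k-1]$ labeled $(b,bk)$; $[0,k-1]\to[k-1,k-1]$ labeled $(b-1,bk-1)$; a self-loop at $[k-1,k-1]$ labeled $(bk+b-1,bk+b-1)$; $[k-1,k-1]\to[k-1,0]$ labeled $(bk-1,b-1)$; $[k-1,0]\to[0,0]$ labeled $(bk,b)$; a self-loop at $[0,0]$ labeled $(0,0)$; and $[0,0]\to[0,k-1]$ labeled $(b,bk)$.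
   Context: Throughout, $g,k$ are integers with $2\le k<g$. The labeled directed graph $H(g,k)$ is built as follows. It has a distinguished starting node, written $[[0,0]]$, and other nodes labeled by pairs $[R,r]$ of integers with $0\le R,r\le k-1$ (the node $[0,0]$ is distinct from the starting node). For a node $[P,p]$ (the starting node being treated as $[P,p]=[0,0]$ for this purpose) there is an edge labeled $(A,a)$ from $[P,p]$ to $[R,r]$ whenever $A,a$ are integers with $0\le A,a\le g-1$, $0\le R,r\le k-1$, and $ka+p=A+rg$, $kA+R=a+Pg$; for edges leaving the starting node one additionally requires $A\neq0$ and $a\neq0$; no edge enters the starting node. $H(g,k)$ consists of the starting node and all nodes reachable from it by such edges. An even pivot node is a node of the form $[a,a]$; an odd pivot node is a node $[r,s]$ having an edge to the node $[s,r]$ (this includes nodes $[a,a]$ with a self-loop); the starting node is not a pivot node. The Young graph $Y(g,k)$ is obtained from $H(g,k)$ by deleting every node that is not a pivot node and from which no pivot node can be reached by a directed path, together with all edges at deleted nodes. Two Young graphs $Y,Y'$ are isomorphic (as Young graphs) if there is a bijection $\phi$ from the nodes of $Y$ to those of $Y'$ that is an isomorphism of the underlying unlabeled directed graphs and such that $x$ is an even (resp. odd) pivot node of $Y$ iff $\phi(x)$ is an even (resp. odd) pivot node of $Y'$. A 1089 graph is a Young graph isomorphic to $Y(10,9)$; $Y(10,9)$ has nodes $[[0,0]],[0,8],[8,8],[8,0],[0,0]$ and edges $[[0,0]]\to[0,8]$, $[0,8]\to[8,8]$, $[8,8]\to[8,8]$, $[8,8]\to[8,0]$, $[8,0]\to[0,0]$,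 $[0,0]\to[0,0]$, $[0,0]\to[0,8]$. -}

module Defs where

open import Data.Nat using (ℕ; _+_; _*_; _<_)
open import Data.Product using (_×_; ∃; ∃-syntax; _,_)
open import Data.Sum using (_⊎_)
open import Data.Unit using (⊤)
open import Data.Empty using (⊥)
open import Relation.Binary.PropositionalEquality using (_≡_; _≢_)

-- Nodes of H(g,k): the distinguished starting node [[0,0]] and nodes [R,r].
data Node : Set where
  start : Node
  nd    : ℕ → ℕ → Node

P-of : Node → ℕ
P-of start    = 0
P-of (nd P _) = P

p-of : Node → ℕ
p-of start    = 0
p-of (nd _ p) = p

StartCond : Node → ℕ → ℕ → Set
StartCond start    A a = (A ≢ 0) × (a ≢ 0)
StartCond (nd _ _) A a = ⊤

-- Edge g k x A a y : there is an edge labeled (A,a) from x to y.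
-- No edge enters the starting node.
Edge : (g k : ℕ) → Node → ℕ → ℕ → Node → Set
Edge g k x A a start    = ⊥
Edge g k x A a (nd R r) =
  (A < g) × (a < g) × (R < k) × (r < k) ×
  (k * a + p-of x ≡ A + r * g) × (k * A + R ≡ a + P-of x * g) ×
  StartCond x A a

data Path (g k : ℕ) : Node → Node → Set where
  here : ∀ {x} → Path g k x x
  step : ∀ {x y z A a} → Edge g k x A a y → Path g k y z → Path g k x z

InH : (g k : ℕ) → Node → Set
InH g k x = Path g k start x

EvenPivot : (g k : ℕ) → Node → Set
EvenPivot g k start    = ⊥
EvenPivot g k (nd R r) = InH g k (nd R r) × (R ≡ r)

OddPivot : (g k : ℕ) → Node → Set
OddPivot g k start    = ⊥
OddPivot g k (nd r s) = InH g k (nd r s) × (∃[ A ] ∃[ a ] Edge g k (nd r s) A a (nd s r))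

Pivot : (g k : ℕ) → Node → Set
Pivot g k x = EvenPivot g k x ⊎ OddPivot g k x

InY : (g k : ℕ) → Node → Set
InY g k x = InH g k x × (Pivot g k x ⊎ (∃[ y ] (Path g k x y × Pivot g k y)))

YEdge : (g k : ℕ) → Node → ℕ → ℕ → Node → Set
YEdge g k x A a y = InY g k x × InY g k y × Edge g k x A a y

YAdj : (g k : ℕ) → Node → Node → Set
YAdj g k x y = ∃[ A ] ∃[ a ] YEdge g k x A a y

record YoungIso (g k g' k' : ℕ) : Set where
  field
    φ     : Node → Node
    ψ     : Node → Node
    φ-in  : ∀ x → InY g k x → InY g' k' (φ x)
    ψ-in  : ∀ y → InY g' k' y → InY g k (ψ y)
    ψφ    : ∀ x → InY g k x → ψ (φ x) ≡ x
    φψ    : ∀ y → InY g' k' y → φ (ψ y) ≡ y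
    adj   : ∀ x y → InY g k x → InY g k y → (YAdj g k x y → YAdj g' k' (φ x) (φ y)) × (YAdj g' k' (φ x) (φ y) → YAdj g k x y)
    even  : ∀ x → InY g k x → (EvenPivot g k x → EvenPivot g' k' (φ x)) × (EvenPivot g' k' (φ x) → EvenPivot g k x)
    odd   : ∀ x → InY g k x → (OddPivot g k x → OddPivot g' k' (φ x)) × (OddPivot g' k' (φ x) → OddPivot g k x)

Is1089 : (g k : ℕ) → Set
Is1089 g k = YoungIso g k 10 9

module Submission where

-- Write k = m + 1.  If g = b(k+1), the two equations of an edge [P,p] → [R,r]
-- labeled (A,a) combine to (k+1)(mA + R) + p = (k+1)(kP + r)b + R, so by
-- uniqueness of division R = p and mA + R = (kP + r)b: the label is determined
-- by its endpoints and, modulo m, consecutive coordinates x₋, x, x₊ along a path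
-- obey (x₋ + x₊)b ≡ x.  A descent on gcd(m,b) shows that a coordinate pair
-- reachable from (0,0) from which a pivot is still reachable is 0 mod m.  Hence
-- the nodes of Y(g,k) are among [[0,0]], [0,m], [m,m], [m,0], [0,0], and solving
-- for the labels identifies Y(g,k) with the canonical graph
-- S → U → V ↺ → W → Z ↺ → U.  Any two canonical graphs, in particular
-- Y(b(k+1),k) and Y(10,9), are isomorphic by matching nodes.  Conversely, an
-- isomorphism Y(g,k) ≅ Y(10,9) fixes the starting node (the only node without
-- in-edges) and produces a walk [[0,0]] → [R,r] → [c,c] ↺ with [R,r] not an odd
-- pivot; its edge equations force R = 0, r = m and then (k+1)·A = g.

open import Data.Nat
open import Data.Nat.Properties
open import Data.Nat.Divisibility
open import Data.Nat.DivMod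
open import Data.Nat.GCD using (gcd; gcd[m,n]∣m; gcd[m,n]∣n; gcd[m,n]≡0⇒m≡0; m/gcd[m,n]≢0)
open import Data.Nat.Coprimality using (Coprime; coprime?; coprime-divisor; gcd≡1⇒coprime)
open import Data.Nat.Induction using (<-wellFounded)
open import Data.Nat.Tactic.RingSolver using (solve-∀)
open import Induction.WellFounded using (Acc; acc)
open import Data.Product
open import Data.Sum
open import Data.Empty
open import Data.List using (List; _∷_; [])
open import Data.List.Membership.Propositional using (_∈_)
open import Data.List.Relation.Unary.Any using (here; there)
open import Function.Bundles using (_⇔_; mk⇔; Equivalence)
open import Relation.Nullary using (¬_; yes; no)
open import Relation.Binary.PropositionalEquality
open import Defs

-- x ≡ y (mod M), written without subtraction.
Congruent : ℕ → ℕ → ℕ → Set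
Congruent M x y = ∃₂ λ u v → x + u * M ≡ y + v * M

congruent-sym : ∀ {M x y} → Congruent M x y → Congruent M y x
congruent-sym (u , v , eq) = v , u , sym eq

congruent-divisor : ∀ {d M x y} → d ∣ M → d ∣ x → Congruent M x y → d ∣ y
congruent-divisor {d} {M} {y = y} d∣M d∣x (u , v , eq) =
  ∣m+n∣m⇒∣n (subst (d ∣_) (+-comm y (v * M)) d∣y+vM) (∣n⇒∣m*n v d∣M)
  where
  d∣y+vM : d ∣ y + v * M
  d∣y+vM = subst (d ∣_) eq (∣m∣n⇒∣m+n d∣x (∣n⇒∣m*n u d∣M))

congruent-cancel : ∀ d {M M′ x x′ y y′} .{{_ : NonZero d}} →
  d * M′ ≡ M → d * x′ ≡ x → d * y′ ≡ y → Congruent M x y → Congruent M′ x′ y′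
congruent-cancel d {M} {M′} {x} {x′} {y} {y′} dM′ dx′ dy′ (u , v , eq) =
  u , v , *-cancelˡ-≡ _ _ d (begin
    d * (x′ + u * M′)     ≡⟨ scale x′ u ⟩
    d * x′ + u * (d * M′) ≡⟨ cong₂ (λ s t → s + u * t) dx′ dM′ ⟩
    x + u * M             ≡⟨ eq ⟩
    y + v * M             ≡⟨ cong₂ (λ s t → s + v * t) dy′ dM′ ⟨
    d * y′ + v * (d * M′) ≡⟨ scale y′ v ⟨
    d * (y′ + v * M′)     ∎)
  where
  open ≡-Reasoning
  scale : ∀ z w → d * (z + w * M′) ≡ d * z + w * (d * M′)
  scale z w = trans (*-distribˡ-+ d z (w * M′))
    (cong (d * z +_) (trans (sym (*-assoc d w M′))
      (trans (cong (_* M′) (*-comm d w)) (*-assoc w d M′))))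

-- Trails of the congruence dynamics (x₋ + x₊)·b ≡ x (mod M) on consecutive
-- triples.  Reach M b P p: the pair (P,p) lies on a trail issuing from (0,0).
data Reach (M b : ℕ) : ℕ → ℕ → Set where
  origin : Reach M b 0 0
  next   : ∀ {P p r} → Reach M b P p → Congruent M ((P + r) * b) p → Reach M b p r

Closed : ℕ → ℕ → ℕ → ℕ → Set
Closed M b P p = P ≡ p ⊎ Congruent M ((P + P) * b) p

data CanClose (M b : ℕ) : ℕ → ℕ → Set where
  closed : ∀ {P p} → Closed M b P p → CanClose M b P p
  onward : ∀ {P p r} → Congruent M ((P + r) * b) p → CanClose M b p r → CanClose M b P p

coprime-reach : ∀ {M b P p} → Coprime M b → Reach M b P p → M ∣ P × M ∣ p
coprime-reach cop origin = divides 0 refl , divides 0 refl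
coprime-reach {M} {b} cop (next {P} {r = r} reach c) =
  M∣p , ∣m+n∣m⇒∣n (coprime-divisor cop M∣b[P+r]) M∣P
  where
  M∣P = proj₁ (coprime-reach cop reach)
  M∣p = proj₂ (coprime-reach cop reach)
  M∣b[P+r] : M ∣ b * (P + r)
  M∣b[P+r] = subst (M ∣_) (*-comm (P + r) b)
    (congruent-divisor ∣-refl M∣p (congruent-sym c))

-- A common factor d of M and b divides every term of a trail after the
-- first, so trails through multiples of d descend to trails modulo M/d.
module CommonFactor {d M b} (M′ : ℕ) .{{_ : NonZero d}} (dM′≡M : d * M′ ≡ M) (d∣b : d ∣ b) where
  d∣M : d ∣ M
  d∣M = divides M′ (trans (sym dM′≡M) (*-comm d M′))

  d∣step : ∀ X {y} → Congruent M (X * b) y → d ∣ y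
  d∣step X = congruent-divisor d∣M (∣n⇒∣m*n X d∣b)

  reach-d∣ : ∀ {P p} → Reach M b P p → d ∣ P
  reach-d∣ origin = divides 0 refl
  reach-d∣ (next {P} {r = r} reach c) = d∣step (P + r) c

  close-d∣ : ∀ {P p} → CanClose M b P p → d ∣ P → d ∣ p
  close-d∣ (closed (inj₁ refl)) d∣P = d∣P
  close-d∣ {P} (closed (inj₂ c)) _ = d∣step (P + P) c
  close-d∣ {P} (onward {r = r} c _) _ = d∣step (P + r) c

  quotient-step : ∀ {P r} → d ∣ P → d ∣ r → d * ((P / d + r / d) * b) ≡ (P + r) * b
  quotient-step d∣P d∣r = trans (sym (*-assoc d _ b))
    (cong (_* b) (trans (*-distribˡ-+ d _ _) (cong₂ _+_ (m*[n/m]≡n d∣P) (m*[n/m]≡n d∣r))))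

  reach-shrink : ∀ {P p} → Reach M b P p → d ∣ p → Reach M′ b (P / d) (p / d)
  reach-shrink origin _ = subst₂ (Reach M′ b) (sym (0/n≡0 d)) (sym (0/n≡0 d)) origin
  reach-shrink (next {P} {r = r} reach c) d∣r = next (reach-shrink reach d∣p)
    (congruent-cancel d dM′≡M (quotient-step (reach-d∣ reach) d∣r) (m*[n/m]≡n d∣p) c)
    where d∣p = d∣step (P + r) c

  close-shrink : ∀ {P p} → CanClose M b P p → d ∣ P → d ∣ p → CanClose M′ b (P / d) (p / d)
  close-shrink (closed (inj₁ refl)) _ _ = closed (inj₁ refl)
  close-shrink (closed (inj₂ c)) d∣P d∣p =
    closed (inj₂ (congruent-cancel d dM′≡M (quotient-step d∣P d∣P) (m*[n/m]≡n d∣p) c))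
  close-shrink (onward c rest) d∣P d∣p = onward
    (congruent-cancel d dM′≡M (quotient-step d∣P d∣r) (m*[n/m]≡n d∣p) c)
    (close-shrink rest d∣p d∣r)
    where d∣r = close-d∣ rest d∣p

-- Coprime moduli are handled directly; otherwise
-- divide M, b and the trails by d = gcd(M,b) > 1 and recurse on M/d.
descent : ∀ {M} b → Acc _<_ M → .{{_ : NonZero M}} → ∀ {P p} →
  Reach M b P p → CanClose M b P p → M ∣ P × M ∣ p
descent {M} b (acc smaller) reach close with coprime? M b
... | yes cop = coprime-reach cop reach
... | no ¬cop = lift d∣P (proj₁ ih) , lift d∣p (proj₂ ih)
  where
  d = gcd M b
  M≢0 : M ≢ 0
  M≢0 = ≢-nonZero⁻¹ M
  d≢0 : d ≢ 0
  d≢0 d≡0 = M≢0 (gcd[m,n]≡0⇒m≡0 d≡0)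
  instance
    d-nonZero : NonZero d
    d-nonZero = ≢-nonZero d≢0
  M′ = M / d
  instance
    M′-nonZero : NonZero M′
    M′-nonZero = ≢-nonZero (m/gcd[m,n]≢0 M b)
  1<d : 1 < d
  1<d = ≤∧≢⇒< (>-nonZero⁻¹ d) (λ 1≡d → ¬cop (gcd≡1⇒coprime (sym 1≡d)))
  dM′≡M : d * M′ ≡ M
  dM′≡M = m*[n/m]≡n (gcd[m,n]∣m M b)
  open CommonFactor M′ dM′≡M (gcd[m,n]∣n M b)
  d∣P = reach-d∣ reach
  d∣p = close-d∣ close d∣P
  ih = descent b (smaller (m/n<m M d 1<d)) (reach-shrink reach d∣p) (close-shrink close d∣P d∣p)
  lift : ∀ {x} → d ∣ x → M′ ∣ x / d → M ∣ x
  lift d∣x M′∣ = subst (_∣ _) dM′≡M (m∣n/o⇒o*m∣n d∣x M′∣)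

reach-and-close : ∀ {M} b .{{_ : NonZero M}} → ∀ {P p} →
  Reach M b P p → CanClose M b P p → M ∣ P × M ∣ p
reach-and-close {M} b = descent b (<-wellFounded M)

last-edge : ∀ {g k x z} → Path g k x z →
  x ≡ z ⊎ ∃ λ y → ∃₂ λ A a → Path g k x y × Edge g k y A a z
last-edge here = inj₁ refl
last-edge (step e path) with last-edge path
... | inj₁ refl = inj₂ (_ , _ , _ , here , e)
... | inj₂ (y , A , a , path′ , e′) = inj₂ (y , A , a , step e path′ , e′)

inH-bounds : ∀ {g k R r} → InH g k (nd R r) → R < k × r < k
inH-bounds path with last-edge path
... | inj₂ (_ , _ , _ , _ , _ , _ , R<k , r<k , _) = R<k , r<k

LeadsToPivot : ℕ → ℕ → Node → Set
LeadsToPivot g k x = Pivot g k x ⊎ ∃ (λ y → Path g k x y × Pivot g k y)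

-- Every node of Y(g,k) other than the starting node has an in-neighbour in
-- Y(g,k): its predecessor on a path from the start still reaches a pivot.
inY-predecessor : ∀ {g k R r} → InY g k (nd R r) → ∃ λ y → YAdj g k y (nd R r)
inY-predecessor {g} {k} {R} {r} inY@(path , toPivot) with last-edge path
... | inj₂ (y , A , a , path′ , e) = y , A , a , (path′ , extend toPivot) , inY , e
  where
  extend : LeadsToPivot g k (nd R r) → LeadsToPivot g k y
  extend (inj₁ pivot) = inj₂ (nd R r , step e here , pivot)
  extend (inj₂ (z , path″ , pivot)) = inj₂ (z , step e path″ , pivot)

-- Reversal symmetry: an edge [P,p] → [R,r] labeled (A,a) between bounded
-- nodes gives an edge [r,R] → [p,P] labeled (a,A); the two edge equations swap.
reverse-edge : ∀ {g k P p A a R r} → P < k → p < k →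
  Edge g k (nd P p) A a (nd R r) → Edge g k (nd r R) a A (nd p P)
reverse-edge P<k p<k (A<g , a<g , _ , _ , E₁ , E₂ , _) = a<g , A<g , p<k , P<k , E₂ , E₁ , _

quotient-remainder-unique : ∀ N .{{_ : NonZero N}} {X Y p R} → p < N → R < N →
  N * X + p ≡ N * Y + R → p ≡ R × X ≡ Y
quotient-remainder-unique N {X} {Y} {p} {R} p<N R<N eq =
  p≡R , *-cancelˡ-≡ X Y N (+-cancelʳ-≡ R _ _ (subst (λ q → N * X + q ≡ N * Y + R) p≡R eq))
  where
  remainder : ∀ Z {q} → q < N → (N * Z + q) % N ≡ q
  remainder Z {q} q<N = begin
    (N * Z + q) % N ≡⟨ cong (_% N) (trans (+-comm (N * Z) q) (cong (q +_) (*-comm N Z))) ⟩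
    (q + Z * N) % N ≡⟨ [m+kn]%n≡m%n q Z N ⟩
    q % N           ≡⟨ m<n⇒m%n≡m q<N ⟩
    q               ∎
    where open ≡-Reasoning
  p≡R : p ≡ R
  p≡R = trans (sym (remainder X p<N)) (trans (cong (_% N) eq) (remainder Y R<N))

small-multiple : ∀ {n R} → suc n ∣ R → R < suc (suc n) → R ≡ 0 ⊎ R ≡ suc n
small-multiple (divides zero refl) _ = inj₁ refl
small-multiple {n} (divides (suc zero) refl) _ = inj₂ (+-identityʳ (suc n))
small-multiple {n} (divides (suc (suc _)) refl) R<2+n =
  ⊥-elim (<⇒≱ (m<m+n (suc n) z<s) (≤-pred R<2+n))

-- The graphs H(g,k) with g = b(k+1), where k = m + 1.  An edge [P,p] → [R,r]
-- then forces R = p, and the label is determined by the nodes; modulo m the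
-- coordinates follow the trail dynamics of Reach/CanClose with modulus m.
module Divisible (m b : ℕ) where
  k g : ℕ
  k = suc m
  g = b * suc k

  -- Multiplying the second edge equation by k and adding the first eliminates a.
  edge-shift : ∀ {x A a R r} → p-of x < k → Edge g k x A a (nd R r) →
    R ≡ p-of x × m * A + R ≡ (k * P-of x + r) * b
  edge-shift {x} {A} {a} {R} {r} p<k (_ , _ , R<k , _ , E₁ , E₂ , _) =
    sym (proj₁ unique) , proj₂ unique
    where
    P = P-of x
    p = p-of x
    eliminate-a : ∀ m A R a p → (1 + m) * ((1 + m) * A + R) + ((1 + m) * a + p) + R
                              ≡ ((2 + m) * (m * A + R) + p) + (A + (1 + m) * a)
    eliminate-a = solve-∀
    scale-g : ∀ m b a P A r R → (1 + m) * (a + P * (b * (2 + m))) + (A + r * (b * (2 + m))) + R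
                                ≡ ((2 + m) * (((1 + m) * P + r) * b) + R) + (A + (1 + m) * a)
    scale-g = solve-∀
    division : suc k * (m * A + R) + p ≡ suc k * ((k * P + r) * b) + R
    division = +-cancelʳ-≡ (A + k * a) _ _ (begin
      (suc k * (m * A + R) + p) + (A + k * a) ≡⟨ eliminate-a m A R a p ⟨
      k * (k * A + R) + (k * a + p) + R       ≡⟨ cong₂ (λ s t → k * s + t + R) E₂ E₁ ⟩
      k * (a + P * g) + (A + r * g) + R       ≡⟨ scale-g m b a P A r R ⟩
      (suc k * ((k * P + r) * b) + R) + (A + k * a) ∎)
      where open ≡-Reasoning
    unique = quotient-remainder-unique (suc k) {m * A + R} {(k * P + r) * b}
               (m≤n⇒m≤1+n p<k) (m≤n⇒m≤1+n R<k) division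

  label-unique : .{{_ : NonZero m}} → ∀ {x y A a A′ a′} → p-of x < k →
    Edge g k x A a y → Edge g k x A′ a′ y → A ≡ A′ × a ≡ a′
  label-unique {x} {nd R r} {A} {a} {A′} {a′} p<k
    e@(_ , _ , _ , _ , _ , E₂ , _) e′@(_ , _ , _ , _ , _ , E₂′ , _) = A≡A′ , a≡a′
    where
    A≡A′ : A ≡ A′
    A≡A′ = *-cancelˡ-≡ A A′ m (+-cancelʳ-≡ R _ _
             (trans (proj₂ (edge-shift p<k e)) (sym (proj₂ (edge-shift p<k e′)))))
    a≡a′ : a ≡ a′
    a≡a′ = +-cancelʳ-≡ (P-of x * g) a a′
             (trans (sym E₂) (trans (cong (λ z → k * z + R) A≡A′) E₂′))

  -- The shifted edge equation, read modulo m (using k ≡ 1 mod m).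
  edge-congruence : ∀ {x A a R r} → p-of x < k → Edge g k x A a (nd R r) →
    R ≡ p-of x × Congruent m ((P-of x + r) * b) (p-of x)
  edge-congruence {x} {A} {R = R} {r} p<k e =
    R≡p , P-of x * b , A , (begin
      (P + r) * b + P * b * m ≡⟨ k≡1 m b P r ⟩
      (k * P + r) * b         ≡⟨ eq ⟨
      m * A + R               ≡⟨ cong (m * A +_) R≡p ⟩
      m * A + p               ≡⟨ trans (+-comm (m * A) p) (cong (p +_) (*-comm m A)) ⟩
      p + A * m               ∎)
    where
    open ≡-Reasoning
    P = P-of x
    p = p-of x
    R≡p = proj₁ (edge-shift p<k e)
    eq = proj₂ (edge-shift p<k e)
    k≡1 : ∀ m b P r → (P + r) * b + P * b * m ≡ ((1 + m) * P + r) * b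
    k≡1 = solve-∀

  edge-bounded : ∀ {x A a y} → Edge g k x A a y → p-of y < k
  edge-bounded {y = nd R r} (_ , _ , _ , r<k , _) = r<k

  reach-along : ∀ {x y} → p-of x < k → Reach m b (P-of x) (p-of x) →
    Path g k x y → Reach m b (P-of y) (p-of y)
  reach-along p<k reach here = reach
  reach-along p<k reach (step {y = nd R r} e path) =
    reach-along (edge-bounded e) (subst (λ P → Reach m b P r) (sym R≡p) (next reach c)) path
    where
    R≡p = proj₁ (edge-congruence p<k e)
    c = proj₂ (edge-congruence p<k e)

  -- Pivot nodes are closed pairs: [a,a] is diagonal, and the edge
  -- [r,s] → [s,r] of an odd pivot is the congruence (r + r)·b ≡ s.
  pivot-closed : ∀ {y} → p-of y < k → Pivot g k y → Closed m b (P-of y) (p-of y)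
  pivot-closed {nd R r} _ (inj₁ (_ , R≡r)) = inj₁ R≡r
  pivot-closed {nd R r} p<k (inj₂ (_ , _ , _ , e)) =
    inj₂ (proj₂ (edge-congruence {x = nd R r} {R = r} {r = R} p<k e))

  close-along : ∀ {x y} → p-of x < k → Path g k x y → Pivot g k y → CanClose m b (P-of x) (p-of x)
  close-along p<k here pivot = closed (pivot-closed p<k pivot)
  close-along p<k (step {y = nd R r} e path) pivot =
    onward c (subst (λ P → CanClose m b P r) R≡p (close-along (edge-bounded e) path pivot))
    where
    R≡p = proj₁ (edge-congruence p<k e)
    c = proj₂ (edge-congruence p<k e)

  inY-divisible : .{{_ : NonZero m}} → ∀ {R r} → InY g k (nd R r) → m ∣ R × m ∣ r
  inY-divisible {R} {r} (path , toPivot) = reach-and-close b reach (close toPivot)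
    where
    reach = reach-along z<s origin path
    r<k = proj₂ (inH-bounds path)
    close : LeadsToPivot g k (nd R r) → CanClose m b R r
    close (inj₁ pivot) = closed (pivot-closed r<k pivot)
    close (inj₂ (_ , path′ , pivot)) = close-along r<k path′ pivot

-- The five nodes of a 1089 graph: S = [[0,0]], U = [0,m], V = [m,m],
-- W = [m,0], Z = [0,0], where m = k - 1.
data Canon : Set where
  S U V W Z : Canon

data Arrow : Canon → Canon → Set where
  S⇒U : Arrow S U
  U⇒V : Arrow U V
  V⇒V : Arrow V V
  V⇒W : Arrow V W
  W⇒Z : Arrow W Z
  Z⇒Z : Arrow Z Z
  Z⇒U : Arrow Z U

-- Its pivot nodes, each both an even and an odd pivot.
data Diagonal : Canon → Set where
  V-diagonal : Diagonal V
  Z-diagonal : Diagonal Z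

-- Reading off a canonical node from the shape of its coordinates; this is a
-- left inverse of every embedding below, since 0 < m.
shape : Node → Canon
shape start = S
shape (nd zero zero) = Z
shape (nd zero (suc _)) = U
shape (nd (suc _) zero) = W
shape (nd (suc _) (suc _)) = V

-- For m = n + 1, k = m + 1 and b = b′ + 1, the Young graph Y(b(k+1),k) is the
-- canonical graph above: its nodes, edges, labels and pivots.
module Canonical (n b′ : ℕ) where
  m b : ℕ
  m = suc n
  b = suc b′
  open Divisible m b public

  emb : Canon → Node
  emb S = start
  emb U = nd 0 m
  emb V = nd m m
  emb W = nd m 0
  emb Z = nd 0 0

  shape-emb : ∀ c → shape (emb c) ≡ c
  shape-emb S = refl
  shape-emb U = refl
  shape-emb V = refl
  shape-emb W = refl
  shape-emb Z = refl

  labelA labela : ∀ {c c′} → Arrow c c′ → ℕ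
  labelA S⇒U = b
  labelA U⇒V = b ∸ 1
  labelA V⇒V = b * k + b ∸ 1
  labelA V⇒W = b * k ∸ 1
  labelA W⇒Z = b * k
  labelA Z⇒Z = 0
  labelA Z⇒U = b
  labela S⇒U = b * k
  labela U⇒V = b * k ∸ 1
  labela V⇒V = b * k + b ∸ 1
  labela V⇒W = b ∸ 1
  labela W⇒Z = b
  labela Z⇒Z = 0
  labela Z⇒U = b * k

  b<g : b < g
  b<g = m<m*n b (suc k) (s≤s (s≤s z≤n))
  bk<g : b * k < g
  bk<g = *-monoʳ-< b (n<1+n k)
  b-1<g : b ∸ 1 < g
  b-1<g = <-trans (n<1+n b′) b<g
  bk-1<g : b * k ∸ 1 < g
  bk-1<g = ≤-<-trans (m∸n≤m (b * k) 1) bk<g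
  g-1<g : b * k + b ∸ 1 < g
  g-1<g = subst (b * k + b ∸ 1 <_) (g≡ n b′) (n<1+n _)
    where
    g≡ : ∀ n b′ → suc ((suc n + b′ * (2 + n)) + suc b′) ≡ suc b′ * (3 + n)
    g≡ = solve-∀

  -- The edges Z → U (labeled (b,bk)), U → V and the loop at V satisfy the
  -- edge equations; the remaining canonical edges are reversals of these.
  Z→U : Edge g k (nd 0 0) b (b * k) (nd 0 m)
  Z→U = b<g , bk<g , z<s , n<1+n m , first n b′ , second n b′ , _
    where
    first : ∀ n b′ → (2 + n) * ((1 + b′) * (2 + n)) + 0 ≡ (1 + b′) + (1 + n) * ((1 + b′) * (3 + n))
    first = solve-∀
    second : ∀ n b′ → (2 + n) * (1 + b′) + 0 ≡ (1 + b′) * (2 + n) + 0 * ((1 + b′) * (3 + n))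
    second = solve-∀

  U→V : Edge g k (nd 0 m) (b ∸ 1) (b * k ∸ 1) (nd m m)
  U→V = b-1<g , bk-1<g , n<1+n m , n<1+n m , first n b′ , second n b′ , _
    where
    first : ∀ n b′ → (2 + n) * ((1 + n) + b′ * (2 + n)) + (1 + n) ≡ b′ + (1 + n) * ((1 + b′) * (3 + n))
    first = solve-∀
    second : ∀ n b′ → (2 + n) * b′ + (1 + n) ≡ ((1 + n) + b′ * (2 + n)) + 0 * ((1 + b′) * (3 + n))
    second = solve-∀

  V→V : Edge g k (nd m m) (b * k + b ∸ 1) (b * k + b ∸ 1) (nd m m)
  V→V = g-1<g , g-1<g , n<1+n m , n<1+n m , loop n b′ , loop n b′ , _
    where
    loop : ∀ n b′ → (2 + n) * (((1 + n) + b′ * (2 + n)) + (1 + b′)) + (1 + n)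
                    ≡ (((1 + n) + b′ * (2 + n)) + (1 + b′)) + (1 + n) * ((1 + b′) * (3 + n))
    loop = solve-∀

  edge : ∀ {c c′} (α : Arrow c c′) → Edge g k (emb c) (labelA α) (labela α) (emb c′)
  edge S⇒U = let (A<g , a<g , R<k , r<k , E₁ , E₂ , _) = Z→U in
             A<g , a<g , R<k , r<k , E₁ , E₂ , (λ ()) , (λ ())
  edge U⇒V = U→V
  edge V⇒V = V→V
  edge V⇒W = reverse-edge z<s (n<1+n m) U→V
  edge W⇒Z = reverse-edge z<s z<s Z→U
  edge Z⇒Z = z<s , z<s , z<s , z<s , zero-loop , zero-loop , _
    where
    zero-loop : k * 0 + 0 ≡ 0 + 0 * g
    zero-loop = cong (_+ 0) (*-zeroʳ k)
  edge Z⇒U = Z→U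

  bounded : ∀ c → p-of (emb c) < k
  bounded S = z<s
  bounded U = n<1+n m
  bounded V = n<1+n m
  bounded W = z<s
  bounded Z = z<s

  -- An edge out of a canonical node starts its target at the source's
  -- second coordinate (edge-shift), which already rules out most pairs.
  shifted : ∀ c {A a R r} → Edge g k (emb c) A a (nd R r) → R ≡ p-of (emb c)
  shifted c e = proj₁ (edge-shift (bounded c) e)

  -- The three remaining non-edges are excluded by their forced label:
  -- [[0,0]] → [0,0] would need A = 0, [0,m] → [m,0] would need m·A + m = 0,
  -- and [m,0] → [0,m] would need A = g.
  no-S⇒Z : ∀ {A a} → ¬ Edge g k start A a (nd 0 0)
  no-S⇒Z {A} e@(_ , _ , _ , _ , _ , _ , A≢0 , _) = A≢0 (m*n≡0⇒m≡0 A m (trans (*-comm A m) mA≡0))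
    where
    mA≡0 : m * A ≡ 0
    mA≡0 = trans (sym (+-identityʳ _))
             (trans (proj₂ (edge-shift z<s e)) (cong (λ z → (z + 0) * b) (*-zeroʳ k)))

  no-U⇒W : ∀ {A a} → ¬ Edge g k (nd 0 m) A a (nd m 0)
  no-U⇒W {A} e = m+1+n≢0 (m * A)
    (trans (proj₂ (edge-shift {x = nd 0 m} (n<1+n m) e)) (cong (λ z → (z + 0) * b) (*-zeroʳ k)))

  no-W⇒U : ∀ {A a} → ¬ Edge g k (nd m 0) A a (nd 0 m)
  no-W⇒U {A} e@(A<g , _) = <-irrefl A≡g A<g
    where
    mg : ∀ n b′ → ((2 + n) * (1 + n) + (1 + n)) * (1 + b′) ≡ (1 + n) * ((1 + b′) * (3 + n)) + 0
    mg = solve-∀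
    A≡g : A ≡ g
    A≡g = *-cancelˡ-≡ A g m (+-cancelʳ-≡ 0 _ _ (trans (proj₂ (edge-shift {x = nd m 0} z<s e)) (mg n b′)))

  arrow : ∀ c c′ {A a} → Edge g k (emb c) A a (emb c′) → Arrow c c′
  arrow _ S ()
  arrow S U _ = S⇒U
  arrow U V _ = U⇒V
  arrow V V _ = V⇒V
  arrow V W _ = V⇒W
  arrow W Z _ = W⇒Z
  arrow Z Z _ = Z⇒Z
  arrow Z U _ = Z⇒U
  arrow S Z e = ⊥-elim (no-S⇒Z e)
  arrow U W e = ⊥-elim (no-U⇒W e)
  arrow W U e = ⊥-elim (no-W⇒U e)
  arrow S V e = ⊥-elim (1+n≢0 (shifted S e))
  arrow S W e = ⊥-elim (1+n≢0 (shifted S e))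
  arrow W V e = ⊥-elim (1+n≢0 (shifted W e))
  arrow W W e = ⊥-elim (1+n≢0 (shifted W e))
  arrow Z V e = ⊥-elim (1+n≢0 (shifted Z e))
  arrow Z W e = ⊥-elim (1+n≢0 (shifted Z e))
  arrow U U e = ⊥-elim (0≢1+n (shifted U e))
  arrow U Z e = ⊥-elim (0≢1+n (shifted U e))
  arrow V U e = ⊥-elim (0≢1+n (shifted V e))
  arrow V Z e = ⊥-elim (0≢1+n (shifted V e))

  classify : ∀ c c′ {A a} → Edge g k (emb c) A a (emb c′) →
    Σ (Arrow c c′) λ α → A ≡ labelA α × a ≡ labela α
  classify c c′ e = α , label-unique (bounded c) e (edge α)
    where α = arrow c c′ e

  -- Every canonical node lies in Y(g,k): the path S → U → V → W → Z runs
  -- through H(g,k), and V, Z are (even) pivots.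
  pathV : InH g k (nd m m)
  pathV = step (edge S⇒U) (step (edge U⇒V) here)
  pathZ : InH g k (nd 0 0)
  pathZ = step (edge S⇒U) (step (edge U⇒V) (step (edge V⇒W) (step (edge W⇒Z) here)))

  inY-emb : ∀ c → InY g k (emb c)
  inY-emb S = here , inj₂ (_ , pathV , inj₁ (pathV , refl))
  inY-emb U = step (edge S⇒U) here , inj₂ (_ , step (edge U⇒V) here , inj₁ (pathV , refl))
  inY-emb V = pathV , inj₁ (inj₁ (pathV , refl))
  inY-emb W = step (edge S⇒U) (step (edge U⇒V) (step (edge V⇒W) here)) ,
              inj₂ (_ , step (edge W⇒Z) here , inj₁ (pathZ , refl))
  inY-emb Z = pathZ , inj₁ (inj₁ (pathZ , refl))

  -- Conversely every node of Y(g,k) is canonical: its coordinates are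
  -- multiples of m below k, i.e. 0 or m.
  inY-canonical : ∀ {x} → InY g k x → ∃ λ c → x ≡ emb c
  inY-canonical {start} _ = S , refl
  inY-canonical {nd R r} inY =
    corner (small-multiple (proj₁ m∣R×m∣r) (proj₁ bounds))
           (small-multiple (proj₂ m∣R×m∣r) (proj₂ bounds))
    where
    m∣R×m∣r = inY-divisible inY
    bounds = inH-bounds (proj₁ inY)
    corner : R ≡ 0 ⊎ R ≡ m → r ≡ 0 ⊎ r ≡ m → ∃ λ c → nd R r ≡ emb c
    corner (inj₁ refl) (inj₁ refl) = Z , refl
    corner (inj₁ refl) (inj₂ refl) = U , refl
    corner (inj₂ refl) (inj₁ refl) = W , refl
    corner (inj₂ refl) (inj₂ refl) = V , refl

  adjacent⇔arrow : ∀ c c′ → YAdj g k (emb c) (emb c′) ⇔ Arrow c c′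
  adjacent⇔arrow c c′ = mk⇔ (λ (_ , _ , _ , _ , e) → arrow c c′ e)
                             (λ α → _ , _ , inY-emb c , inY-emb c′ , edge α)

  even⇔diagonal : ∀ c → EvenPivot g k (emb c) ⇔ Diagonal c
  even⇔diagonal c = mk⇔ (to c) from
    where
    to : ∀ c → EvenPivot g k (emb c) → Diagonal c
    to U (_ , ())
    to V _ = V-diagonal
    to W (_ , ())
    to Z _ = Z-diagonal
    from : Diagonal c → EvenPivot g k (emb c)
    from V-diagonal = pathV , refl
    from Z-diagonal = pathZ , refl

  -- The odd pivots are the nodes with a loop: U and W are not, as there is
  -- no canonical edge between them.
  odd⇔diagonal : ∀ c → OddPivot g k (emb c) ⇔ Diagonal c
  odd⇔diagonal c = mk⇔ (to c) from
    where
    to : ∀ c → OddPivot g k (emb c) → Diagonal c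
    to U (_ , _ , _ , e) = ⊥-elim (no-U⇒W e)
    to V _ = V-diagonal
    to W (_ , _ , _ , e) = ⊥-elim (no-W⇒U e)
    to Z _ = Z-diagonal
    from : Diagonal c → OddPivot g k (emb c)
    from V-diagonal = pathV , _ , _ , edge V⇒V
    from Z-diagonal = pathZ , _ , _ , edge Z⇒Z

module Listing (n b′ : ℕ) where
  open Canonical n b′

  nodes : List Node
  nodes = start ∷ nd 0 m ∷ nd m m ∷ nd m 0 ∷ nd 0 0 ∷ []

  edges : List (Node × ℕ × ℕ × Node)
  edges = (start , b , b * k , nd 0 m) ∷
          (nd 0 m , b ∸ 1 , b * k ∸ 1 , nd m m) ∷
          (nd m m , b * k + b ∸ 1 , b * k + b ∸ 1 , nd m m) ∷
          (nd m m , b * k ∸ 1 , b ∸ 1 , nd m 0) ∷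
          (nd m 0 , b * k , b , nd 0 0) ∷
          (nd 0 0 , 0 , 0 , nd 0 0) ∷
          (nd 0 0 , b , b * k , nd 0 m) ∷ []

  emb∈nodes : ∀ c → emb c ∈ nodes
  emb∈nodes S = here refl
  emb∈nodes U = there (here refl)
  emb∈nodes V = there (there (here refl))
  emb∈nodes W = there (there (there (here refl)))
  emb∈nodes Z = there (there (there (there (here refl))))

  nodes⊆emb : ∀ {x} → x ∈ nodes → ∃ λ c → x ≡ emb c
  nodes⊆emb (here refl) = S , refl
  nodes⊆emb (there (here refl)) = U , refl
  nodes⊆emb (there (there (here refl))) = V , refl
  nodes⊆emb (there (there (there (here refl)))) = W , refl
  nodes⊆emb (there (there (there (there (here refl))))) = Z , refl

  arrow∈edges : ∀ {c c′} (α : Arrow c c′) → (emb c , labelA α , labela α , emb c′) ∈ edges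
  arrow∈edges S⇒U = here refl
  arrow∈edges U⇒V = there (here refl)
  arrow∈edges V⇒V = there (there (here refl))
  arrow∈edges V⇒W = there (there (there (here refl)))
  arrow∈edges W⇒Z = there (there (there (there (here refl))))
  arrow∈edges Z⇒Z = there (there (there (there (there (here refl)))))
  arrow∈edges Z⇒U = there (there (there (there (there (there (here refl))))))

  edges⊆arrows : ∀ {t} → t ∈ edges →
    ∃₂ λ c c′ → Σ (Arrow c c′) λ α → t ≡ (emb c , labelA α , labela α , emb c′)
  edges⊆arrows (here refl) = _ , _ , S⇒U , refl
  edges⊆arrows (there (here refl)) = _ , _ , U⇒V , refl
  edges⊆arrows (there (there (here refl))) = _ , _ , V⇒V , refl
  edges⊆arrows (there (there (there (here refl)))) = _ , _ , V⇒W , refl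
  edges⊆arrows (there (there (there (there (here refl))))) = _ , _ , W⇒Z , refl
  edges⊆arrows (there (there (there (there (there (here refl)))))) = _ , _ , Z⇒Z , refl
  edges⊆arrows (there (there (there (there (there (there (here refl))))))) = _ , _ , Z⇒U , refl

  node-characterization : ∀ x → InY g k x ⇔ x ∈ nodes
  node-characterization x = mk⇔ to from
    where
    to : InY g k x → x ∈ nodes
    to inY with inY-canonical inY
    ... | c , refl = emb∈nodes c
    from : x ∈ nodes → InY g k x
    from x∈ with nodes⊆emb x∈
    ... | c , refl = inY-emb c

  edge-characterization : ∀ x A a y → YEdge g k x A a y ⇔ ((x , A , a , y) ∈ edges)
  edge-characterization x A a y = mk⇔ to from
    where
    to : YEdge g k x A a y → (x , A , a , y) ∈ edges
    to (inYx , inYy , e) with inY-canonical inYx | inY-canonical inYy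
    ... | c , refl | c′ , refl with classify c c′ e
    ... | α , refl , refl = arrow∈edges α
    from : (x , A , a , y) ∈ edges → YEdge g k x A a y
    from t∈ with edges⊆arrows t∈
    ... | c , c′ , α , refl = inY-emb c , inY-emb c′ , edge α

  characterization : (∀ x → InY g k x ⇔ x ∈ nodes) ×
                     (∀ x A a y → YEdge g k x A a y ⇔ ((x , A , a , y) ∈ edges))
  characterization = node-characterization , edge-characterization

through : ∀ {A B C : Set} → A ⇔ C → B ⇔ C → (A → B) × (B → A)
through A⇔C B⇔C = (λ a → Equivalence.from B⇔C (Equivalence.to A⇔C a)) ,
                  (λ b → Equivalence.from A⇔C (Equivalence.to B⇔C b))

-- Any two canonical Young graphs are isomorphic: match nodes by shape.  Every
-- field reduces, via x ≡ emb c, to the canonical descriptions above.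
module Isomorphic (n₁ b₁ n₂ b₂ : ℕ) where
  module C₁ = Canonical n₁ b₁
  module C₂ = Canonical n₂ b₂

  φ ψ : Node → Node
  φ x = C₂.emb (shape x)
  ψ y = C₁.emb (shape y)

  Canonical₁ Canonical₂ : Node → Set
  Canonical₁ x = ∃ λ c → x ≡ C₁.emb c
  Canonical₂ y = ∃ λ c → y ≡ C₂.emb c

  ψφ : ∀ x → Canonical₁ x → ψ (φ x) ≡ x
  ψφ _ (c , refl) rewrite C₁.shape-emb c | C₂.shape-emb c = refl

  φψ : ∀ y → Canonical₂ y → φ (ψ y) ≡ y
  φψ _ (c , refl) rewrite C₂.shape-emb c | C₁.shape-emb c = refl

  adj : ∀ x y → Canonical₁ x → Canonical₁ y →
    (YAdj C₁.g C₁.k x y → YAdj C₂.g C₂.k (φ x) (φ y)) ×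
    (YAdj C₂.g C₂.k (φ x) (φ y) → YAdj C₁.g C₁.k x y)
  adj _ _ (c , refl) (c′ , refl) rewrite C₁.shape-emb c | C₁.shape-emb c′ =
    through (C₁.adjacent⇔arrow c c′) (C₂.adjacent⇔arrow c c′)

  even : ∀ x → Canonical₁ x →
    (EvenPivot C₁.g C₁.k x → EvenPivot C₂.g C₂.k (φ x)) ×
    (EvenPivot C₂.g C₂.k (φ x) → EvenPivot C₁.g C₁.k x)
  even _ (c , refl) rewrite C₁.shape-emb c = through (C₁.even⇔diagonal c) (C₂.even⇔diagonal c)

  odd : ∀ x → Canonical₁ x →
    (OddPivot C₁.g C₁.k x → OddPivot C₂.g C₂.k (φ x)) ×
    (OddPivot C₂.g C₂.k (φ x) → OddPivot C₁.g C₁.k x)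
  odd _ (c , refl) rewrite C₁.shape-emb c = through (C₁.odd⇔diagonal c) (C₂.odd⇔diagonal c)

  iso : YoungIso C₁.g C₁.k C₂.g C₂.k
  iso = record
    { φ = φ
    ; ψ = ψ
    ; φ-in = λ x _ → C₂.inY-emb (shape x)
    ; ψ-in = λ y _ → C₁.inY-emb (shape y)
    ; ψφ = λ x inY → ψφ x (C₁.inY-canonical inY)
    ; φψ = λ y inY → φψ y (C₂.inY-canonical inY)
    ; adj = λ x y inYx inYy → adj x y (C₁.inY-canonical inYx) (C₁.inY-canonical inYy)
    ; even = λ x inY → even x (C₁.inY-canonical inY)
    ; odd = λ x inY → odd x (C₁.inY-canonical inY)
    }

-- Y(10,9) is the canonical graph with k = 9, b = 1.
module Y₁₀₈₉ = Canonical 7 0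

canonical-1089 : ∀ n b′ → Is1089 (suc b′ * suc (suc (suc n))) (suc (suc n))
canonical-1089 n b′ = Isomorphic.iso n b′ 7 0

module Pullback {g k g′ k′} (I : YoungIso g k g′ k′) where
  open YoungIso I

  pull-adjacent : ∀ {y y′} → InY g′ k′ y → InY g′ k′ y′ →
    YAdj g′ k′ y y′ → YAdj g k (ψ y) (ψ y′)
  pull-adjacent {y} {y′} inY inY′ adjacent = proj₂ (adj _ _ (ψ-in y inY) (ψ-in y′ inY′))
    (subst₂ (YAdj g′ k′) (sym (φψ y inY)) (sym (φψ y′ inY′)) adjacent)

  pull-even : ∀ {y} → InY g′ k′ y → EvenPivot g′ k′ y → EvenPivot g k (ψ y)
  pull-even {y} inY even′ = proj₂ (even _ (ψ-in y inY)) (subst (EvenPivot g′ k′) (sym (φψ y inY)) even′)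

  push-odd : ∀ {y} → InY g′ k′ y → OddPivot g k (ψ y) → OddPivot g′ k′ y
  push-odd {y} inY odd₁ = subst (OddPivot g′ k′) (φψ y inY) (proj₁ (odd _ (ψ-in y inY)) odd₁)

  -- The isomorphism fixes the starting node: otherwise ψ start would have an
  -- in-neighbour y in Y (inY-predecessor), and φ y would be an in-neighbour of
  -- φ (ψ start) = start, which has no incoming edges.
  ψ-start : InY g′ k′ start → ψ start ≡ start
  ψ-start inY = fixed (ψ start) refl
    where
    fixed : ∀ x → x ≡ ψ start → x ≡ start
    fixed start _ = refl
    fixed (nd R r) x≡ with inY-predecessor (subst (InY g k) (sym x≡) (ψ-in start inY))
    ... | y , A , a , inYy , inYx , e
      with subst (YAdj g′ k′ (φ y)) (trans (cong φ x≡) (φψ start inY))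
                 (proj₁ (adj y (nd R r) inYy inYx) (A , a , inYy , inYx , e))
    ... | _ , _ , _ , _ , ()

-- The arithmetic behind "1089 graph ⇒ (k+1) ∣ g", for k = m + 1 with m ≥ 1:
-- a walk [[0,0]] → [R,r] → [c,c] ↺ in which [R,r] is not an odd pivot forces
-- R = 0 and r = m, and the first edge then reads (k+1)·A = g.
module WalkArithmetic (n g : ℕ) where
  m k : ℕ
  m = suc n
  k = suc m

  -- First edge: eliminating a = kA + R gives m(k+1)·A + k·R = r·g.
  start-edge : ∀ {A a R r} → Edge g k start A a (nd R r) → m * suc k * A + k * R ≡ r * g
  start-edge {A} {a} {R} {r} (_ , _ , _ , _ , E₁ , E₂ , _) = +-cancelʳ-≡ A _ _ (begin
    (m * suc k * A + k * R) + A ≡⟨ square n A R ⟨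
    k * (k * A + R) + 0         ≡⟨ cong (λ z → k * z + 0) (trans E₂ (+-identityʳ a)) ⟩
    k * a + 0                   ≡⟨ E₁ ⟩
    A + r * g                   ≡⟨ +-comm A (r * g) ⟩
    r * g + A                   ∎)
    where
    open ≡-Reasoning
    square : ∀ n A R → (2 + n) * ((2 + n) * A + R) + 0 ≡ ((1 + n) * (3 + n) * A + (2 + n) * R) + A
    square = solve-∀

  -- The first edge leaves r ≠ 0, since its label A is nonzero.
  start-edge-r≢0 : ∀ {A a R} → ¬ Edge g k start A a (nd R 0)
  start-edge-r≢0 {suc A} e with start-edge e
  ... | ()
  start-edge-r≢0 {zero} (_ , _ , _ , _ , _ , _ , A≢0 , _) = A≢0 refl

  -- A loop at a diagonal node [c,c] has equal labels, so m·D + c = c·g.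
  loop-edge : ∀ {c D δ} → Edge g k (nd c c) D δ (nd c c) → m * D + c ≡ c * g
  loop-edge {c} {D} {δ} (_ , _ , _ , _ , G₁ , G₂ , _) = +-cancelʳ-≡ D _ _ (begin
    (m * D + c) + D ≡⟨ shift n D c ⟩
    k * D + c       ≡⟨ G₂ ⟩
    δ + c * g       ≡⟨ cong (_+ c * g) δ≡D ⟩
    D + c * g       ≡⟨ +-comm D (c * g) ⟩
    c * g + D       ∎)
    where
    open ≡-Reasoning
    shift : ∀ n D c → ((1 + n) * D + c) + D ≡ (2 + n) * D + c
    shift = solve-∀
    sum₁ : ∀ n δ c cg → ((2 + n) * δ + c) + (δ + cg) ≡ (3 + n) * δ + (c + cg)
    sum₁ = solve-∀
    sum₂ : ∀ n D c cg → (D + cg) + ((2 + n) * D + c) ≡ (3 + n) * D + (c + cg)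
    sum₂ = solve-∀
    δ≡D : δ ≡ D
    δ≡D = *-cancelˡ-≡ δ D (suc k) (+-cancelʳ-≡ (c + c * g) _ _
      (trans (sym (sum₁ n δ c (c * g))) (trans (cong₂ _+_ G₁ (sym G₂)) (sum₂ n D c (c * g)))))

  -- An edge [R,r] → [c,c] followed by a loop: adding the edge equations and
  -- using the loop to eliminate c gives m·(β + B) + r = m·D + R·g.
  into-loop : ∀ {R r B β c D δ} → Edge g k (nd R r) B β (nd c c) → Edge g k (nd c c) D δ (nd c c) →
    m * (β + B) + r ≡ m * D + R * g
  into-loop {R} {r} {B} {β} {c} {D} (_ , _ , _ , _ , F₁ , F₂ , _) loop = +-cancelʳ-≡ c _ _
    (+-cancelʳ-≡ (B + β) _ _ (begin
      (m * (β + B) + r + c) + (B + β) ≡⟨ add n β r B c ⟨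
      (k * β + r) + (k * B + c)       ≡⟨ cong₂ _+_ F₁ F₂ ⟩
      (B + c * g) + (β + R * g)       ≡⟨ regroup B β (c * g) (R * g) ⟩
      (c * g + R * g) + (B + β)       ≡⟨ cong (λ z → (z + R * g) + (B + β)) (loop-edge loop) ⟨
      (m * D + c + R * g) + (B + β)   ≡⟨ cong (_+ (B + β)) (exchange (m * D) c (R * g)) ⟩
      (m * D + R * g + c) + (B + β)   ∎))
    where
    open ≡-Reasoning
    add : ∀ n β r B c → ((2 + n) * β + r) + ((2 + n) * B + c) ≡ ((1 + n) * (β + B) + r + c) + (B + β)
    add = solve-∀
    regroup : ∀ B β cg Rg → (B + cg) + (β + Rg) ≡ (cg + Rg) + (B + β)
    regroup = solve-∀
    exchange : ∀ x y z → x + y + z ≡ x + z + y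
    exchange = solve-∀

  start-edge-divides : ∀ {A a} → Edge g k start A a (nd 0 m) → suc k ∣ g
  start-edge-divides {A} e = divides A (trans (sym (*-cancelˡ-≡ (suc k * A) g m m[k+1]A≡mg)) (*-comm (suc k) A))
    where
    m[k+1]A≡mg : m * (suc k * A) ≡ m * g
    m[k+1]A≡mg = begin
      m * (suc k * A)         ≡⟨ *-assoc m (suc k) A ⟨
      m * suc k * A           ≡⟨ +-identityʳ _ ⟨
      m * suc k * A + 0       ≡⟨ cong (m * suc k * A +_) (*-zeroʳ k) ⟨
      m * suc k * A + k * 0   ≡⟨ start-edge e ⟩
      m * g                   ∎
      where open ≡-Reasoning

  -- If R ≥ 1 and m·X + r = m·D + R·g with 0 < r < k < g, then C = X − D labels
  -- an edge [R,r] → [r,R]: both edge equations become k·C + r = C + R·g.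
  odd-edge : ∀ {R r X D} → k < g → 0 < R → R < k → 0 < r → r < k →
    m * X + r ≡ m * D + R * g → ∃ λ C → Edge g k (nd R r) C C (nd r R)
  odd-edge {R} {r} {X} {D} k<g 0<R R<k 0<r r<k eq = C , C<g , C<g , r<k , R<k , edge-eq , edge-eq , _
    where
    g≤Rg : g ≤ R * g
    g≤Rg = m≤n*m g R {{>-nonZero 0<R}}
    D<X : D < X
    D<X = *-cancelˡ-< m D X (+-cancelʳ-< r (m * D) (m * X) (begin-strict
      m * D + r     <⟨ +-monoʳ-< (m * D) (<-≤-trans (<-trans r<k k<g) g≤Rg) ⟩
      m * D + R * g ≡⟨ eq ⟨
      m * X + r     ∎))
      where open ≤-Reasoning
    C = X ∸ D
    mC+r≡Rg : m * C + r ≡ R * g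
    mC+r≡Rg = +-cancelʳ-≡ (m * D) _ _ (begin
      (m * C + r) + m * D ≡⟨ split n C D r ⟨
      m * (C + D) + r     ≡⟨ cong (λ z → m * z + r) (m∸n+n≡m (<⇒≤ D<X)) ⟩
      m * X + r           ≡⟨ eq ⟩
      m * D + R * g       ≡⟨ +-comm (m * D) (R * g) ⟩
      R * g + m * D       ∎)
      where
      open ≡-Reasoning
      split : ∀ n C D r → (1 + n) * (C + D) + r ≡ ((1 + n) * C + r) + (1 + n) * D
      split = solve-∀
    C<g : C < g
    C<g = *-cancelˡ-< m C g (begin-strict
      m * C     <⟨ m<m+n (m * C) 0<r ⟩
      m * C + r ≡⟨ mC+r≡Rg ⟩
      R * g     ≤⟨ *-monoˡ-≤ g (≤-pred R<k) ⟩
      m * g     ∎)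
      where open ≤-Reasoning
    edge-eq : k * C + r ≡ C + R * g
    edge-eq = trans (+-assoc C (m * C) r) (cong (C +_) mC+r≡Rg)

  -- The case r = 0 is excluded by the first edge; for R = 0, into-loop makes
  -- r a multiple of m, so r = m; for R ≥ 1, odd-edge contradicts the hypothesis.
  walk-divides : ∀ {A a R r B β c D δ} → k < g →
    Edge g k start A a (nd R r) → Edge g k (nd R r) B β (nd c c) → Edge g k (nd c c) D δ (nd c c) →
    (∀ C → ¬ Edge g k (nd R r) C C (nd r R)) → suc k ∣ g
  walk-divides {r = zero} _ first _ _ _ = ⊥-elim (start-edge-r≢0 first)
  walk-divides {R = zero} {suc r′} {B} {β} {D = D} _ first@(_ , _ , _ , r<k , _) second loop _
    with small-multiple m∣r r<k
    where
    m∣r : m ∣ suc r′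
    m∣r = ∣m+n∣m⇒∣n
      (subst (m ∣_) (sym (into-loop {R = zero} second loop)) (∣m∣n⇒∣m+n (m∣m*n D) (divides 0 refl)))
      (m∣m*n (β + B))
  ... | inj₁ ()
  ... | inj₂ refl = start-edge-divides first
  walk-divides {R = suc R′} {suc r′} {D = D} k<g first@(_ , _ , R<k , r<k , _) second loop not-odd =
    ⊥-elim (uncurry not-odd (odd-edge {D = D} k<g z<s R<k z<s r<k (into-loop {R = suc R′} second loop)))

walk-in-Y-divides : ∀ n {g u v} → suc (suc n) < g →
  YAdj g (suc (suc n)) start u → YAdj g (suc (suc n)) u v → YAdj g (suc (suc n)) v v →
  EvenPivot g (suc (suc n)) v → ¬ OddPivot g (suc (suc n)) u → suc (suc (suc n)) ∣ g
walk-in-Y-divides n {u = nd R r} {nd c .c} k<g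
  (_ , _ , _ , (inH , _) , first) (_ , _ , _ , _ , second) (_ , _ , _ , _ , loop) (_ , refl) not-odd =
  WalkArithmetic.walk-divides n _ k<g first second loop (λ C e → not-odd (inH , C , C , e))

-- In a 1089 graph the images of S → U → V ↺ in Y(10,9) form such a walk.
1089-divides : ∀ n {g} → suc (suc n) < g → Is1089 g (suc (suc n)) → suc (suc (suc n)) ∣ g
1089-divides n k<g I =
  walk-in-Y-divides n k<g start→u (adjacent U⇒V) (adjacent V⇒V) v-even u-not-odd
  where
  open YoungIso I
  open Pullback I
  module Y = Y₁₀₈₉
  adjacent : ∀ {c c′} → Arrow c c′ → YAdj _ _ (ψ (Y.emb c)) (ψ (Y.emb c′))
  adjacent {c} {c′} α =
    pull-adjacent (Y.inY-emb c) (Y.inY-emb c′) (Equivalence.from (Y.adjacent⇔arrow c c′) α)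
  start→u : YAdj _ _ start (ψ (Y.emb U))
  start→u = subst (λ x → YAdj _ _ x (ψ (Y.emb U))) (ψ-start (Y.inY-emb S)) (adjacent S⇒U)
  v-even : EvenPivot _ _ (ψ (Y.emb V))
  v-even = pull-even (Y.inY-emb V) (Equivalence.from (Y.even⇔diagonal V) V-diagonal)
  u-not-odd : ¬ OddPivot _ _ (ψ (Y.emb U))
  u-not-odd odd₁ = U-not-diagonal (Equivalence.to (Y.odd⇔diagonal U) (push-odd (Y.inY-emb U) odd₁))
    where
    U-not-diagonal : ¬ Diagonal U
    U-not-diagonal ()

divides-1089 : ∀ n {g} → suc (suc n) < g → suc (suc (suc n)) ∣ g → Is1089 g (suc (suc n))
divides-1089 n k<g (divides zero refl) = ⊥-elim (n≮0 k<g)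
divides-1089 n k<g (divides (suc b′) refl) = canonical-1089 n b′

theorem2 : (g k : ℕ) → 2 ≤ k → k < g →
    (Is1089 g k ⇔ (suc k ∣ g)) ×
    ((b : ℕ) → 0 < b → g ≡ b * suc k → Is1089 g k →
      ((x : Node) → InY g k x ⇔
        (x ∈ (start ∷ nd 0 (k ∸ 1) ∷ nd (k ∸ 1) (k ∸ 1) ∷ nd (k ∸ 1) 0 ∷ nd 0 0 ∷ []))) ×
      ((x : Node) (A a : ℕ) (y : Node) → YEdge g k x A a y ⇔
        ((x , A , a , y) ∈
          ((start , b , b * k , nd 0 (k ∸ 1)) ∷
           (nd 0 (k ∸ 1) , b ∸ 1 , b * k ∸ 1 , nd (k ∸ 1) (k ∸ 1)) ∷
           (nd (k ∸ 1) (k ∸ 1) , b * k + b ∸ 1 , b * k + b ∸ 1 , nd (k ∸ 1) (k ∸ 1)) ∷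
           (nd (k ∸ 1) (k ∸ 1) , b * k ∸ 1 , b ∸ 1 , nd (k ∸ 1) 0) ∷
           (nd (k ∸ 1) 0 , b * k , b , nd 0 0) ∷
           (nd 0 0 , 0 , 0 , nd 0 0) ∷
           (nd 0 0 , b , b * k , nd 0 (k ∸ 1)) ∷ []))))
theorem2 g (suc (suc n)) (s≤s (s≤s z≤n)) k<g =
  mk⇔ (1089-divides n k<g) (divides-1089 n k<g) ,
  λ { (suc b′) _ refl _ → Listing.characterization n b′ }
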